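{- Let $r$ be an odd natural number. Then $C_{S(2^r)^*}\leq 2$.
   Context: For a natural number $m$, $\mathbb Z_m=\mathbb Z/m\mathbb Z$ and $S(m)^*=\{x^2:x\in\mathbb Z_m\}\setminus\{0\}$. For $A\subseteq\mathbb Z_m$, a subsequence $T$ of a sequence $(x_1,\dots,x_k)$ in $\mathbb Z_m$, with nonempty index set $I$, is an $A$-weighted zero-sum subsequence if there exist $a_i\in A$ ($i\in I$) with $\sum_{i\in I}a_ix_i=0$. $C_{S(m)^*}$ is the least positive integer $k$ such that every sequence of length $k$ in $\mathbb Z_m$ has an $S(m)^*$-weighted zero-sum subsequence consisting of consecutive terms. -}

module Defs where

open import Data.Nat using (ℕ; zero; suc; _+_; _*_; _^_; _<_; _≤_; NonZero)
open import Data.Nat.DivMod using (_%_)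
open import Data.Fin using (Fin; toℕ)
open import Data.List using (List; []; _∷_; _++_; length; zipWith)
open import Data.Nat.ListAction using (sum)
open import Data.List.Relation.Unary.All using (All)
open import Data.Product using (Σ; ∃; ∃-syntax; _×_)
open import Relation.Binary.PropositionalEquality using (_≡_; _≢_)
open import Relation.Nullary using (¬_)

-- ℤ_m is represented by Fin m (residues 0..m-1); arithmetic is taken mod m.

InSstar : (m : ℕ) .{{_ : NonZero m}} → Fin m → Set
InSstar m a = (toℕ a ≢ 0) × ∃[ x ] ((toℕ {m} x * toℕ x) % m ≡ toℕ a)

WeightedZeroSum : (m : ℕ) .{{_ : NonZero m}} → List (Fin m) → Set
WeightedZeroSum m T =
  (T ≢ []) ×
  ∃[ ws ] (length ws ≡ length T × All (InSstar m) ws ×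
           (sum (zipWith (λ a x → toℕ a * toℕ x) ws T) % m ≡ 0))

HasConsecutiveWZS : (m : ℕ) .{{_ : NonZero m}} → List (Fin m) → Set
HasConsecutiveWZS m xs =
  ∃[ pre ] ∃[ T ] ∃[ post ] (xs ≡ pre ++ T ++ post × WeightedZeroSum m T)

Prop-k : (m : ℕ) .{{_ : NonZero m}} → ℕ → Set
Prop-k m k = (xs : List (Fin m)) → length xs ≡ k → HasConsecutiveWZS m xs

IsC-Sstar : (m : ℕ) .{{_ : NonZero m}} → ℕ → Set
IsC-Sstar m c = (1 ≤ c) × Prop-k m c × ((k : ℕ) → 1 ≤ k → k < c → ¬ Prop-k m k)

Odd : ℕ → Set
Odd r = ∃[ q ] (r ≡ suc (2 * q))

-- With m = 2^(2q+1), the element h = 2^(2q) = (2^q)^2 is a nonzero square and 2h = m.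
-- Weighting by h kills every even residue, and kills the sum of any two odd residues;
-- so among two consecutive terms either one of them is even or both are odd.
-- A single term 1 admits no weighted zero-sum, since a weight a ≠ 0 gives a * 1 = a ≠ 0.
module Submission where

open import Defs
open import Data.Nat using (ℕ; zero; suc; _+_; _*_; _^_; _<_; _≤_; z≤n; s≤s; NonZero)
open import Data.Nat.Properties
open import Data.Nat.DivMod using (_%_; m*n%n≡0; m<n⇒m%n≡m)
open import Data.Nat.Tactic.RingSolver using (solve-∀)
open import Data.Fin using (Fin; toℕ; fromℕ<)
open import Data.Fin.Properties using (toℕ-fromℕ<; toℕ<n)
open import Data.List using ([]; _∷_)
open import Data.List.Relation.Unary.All using ([]; _∷_)
open import Data.Product using (∃-syntax; _×_; _,_)
open import Data.Sum using (_⊎_; inj₁; inj₂)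
open import Relation.Binary.PropositionalEquality
open import Relation.Nullary using (¬_)
open import Data.Empty using (⊥-elim)

even⊎odd : ∀ n → (∃[ j ] n ≡ 2 * j) ⊎ (∃[ j ] n ≡ suc (2 * j))
even⊎odd zero = inj₁ (0 , refl)
even⊎odd (suc n) with even⊎odd n
... | inj₁ (j , n≡2j)   = inj₂ (j , cong suc n≡2j)
... | inj₂ (j , n≡2j+1) = inj₁ (suc j , trans (cong suc n≡2j+1) (2+2j≡2[1+j] j))
  where
  2+2j≡2[1+j] : ∀ j → suc (suc (2 * j)) ≡ 2 * suc j
  2+2j≡2[1+j] = solve-∀

module _ {m : ℕ} .{{_ : NonZero m}} where

  wzs-singleton : ∀ {a x : Fin m} → InSstar m a → (toℕ a * toℕ x) % m ≡ 0 →
                  WeightedZeroSum m (x ∷ [])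
  wzs-singleton {a} {x} a∈S ax≡0 =
    (λ ()) , a ∷ [] , refl , a∈S ∷ [] ,
    trans (cong (_% m) (+-identityʳ (toℕ a * toℕ x))) ax≡0

  wzs-pair : ∀ {a x y : Fin m} → InSstar m a → (toℕ a * toℕ x + toℕ a * toℕ y) % m ≡ 0 →
             WeightedZeroSum m (x ∷ y ∷ [])
  wzs-pair {a} {x} {y} a∈S axy≡0 =
    (λ ()) , a ∷ a ∷ [] , refl , a∈S ∷ a∈S ∷ [] ,
    trans (cong (λ s → (toℕ a * toℕ x + s) % m) (+-identityʳ (toℕ a * toℕ y))) axy≡0

  half*even%m≡0 : ∀ n → 2 * n ≡ m → ∀ k → (n * (2 * k)) % m ≡ 0
  half*even%m≡0 n 2n≡m k = begin
    (n * (2 * k)) % m ≡⟨ cong (_% m) (trans (swap n k) (cong (k *_) 2n≡m)) ⟩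
    (k * m) % m       ≡⟨ m*n%n≡0 k m ⟩
    0                 ∎
    where
    open ≡-Reasoning
    swap : ∀ n k → n * (2 * k) ≡ k * (2 * n)
    swap = solve-∀

  half*[odd+odd]%m≡0 : ∀ n → 2 * n ≡ m → ∀ i j → (n * suc (2 * i) + n * suc (2 * j)) % m ≡ 0
  half*[odd+odd]%m≡0 n 2n≡m i j = begin
    (n * suc (2 * i) + n * suc (2 * j)) % m ≡⟨ cong (_% m) (trans (collect n i j) (cong (suc (i + j) *_) 2n≡m)) ⟩
    (suc (i + j) * m) % m                   ≡⟨ m*n%n≡0 (suc (i + j)) m ⟩
    0                                       ∎
    where
    open ≡-Reasoning
    collect : ∀ n i j → n * suc (2 * i) + n * suc (2 * j) ≡ suc (i + j) * (2 * n)
    collect = solve-∀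

  prop-2-of-half : (h : Fin m) → InSstar m h → 2 * toℕ h ≡ m → Prop-k m 2
  prop-2-of-half h h∈S 2h≡m (x ∷ y ∷ []) refl
    with even⊎odd (toℕ x) | even⊎odd (toℕ y)
  ... | inj₁ (i , x≡2i) | _ =
    [] , x ∷ [] , y ∷ [] , refl ,
    wzs-singleton h∈S (subst (λ u → (toℕ h * u) % m ≡ 0) (sym x≡2i) (half*even%m≡0 (toℕ h) 2h≡m i))
  ... | inj₂ _ | inj₁ (j , y≡2j) =
    x ∷ [] , y ∷ [] , [] , refl ,
    wzs-singleton h∈S (subst (λ u → (toℕ h * u) % m ≡ 0) (sym y≡2j) (half*even%m≡0 (toℕ h) 2h≡m j))
  ... | inj₂ (i , x≡2i+1) | inj₂ (j , y≡2j+1) =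
    [] , x ∷ y ∷ [] , [] , refl ,
    wzs-pair h∈S (subst₂ (λ u v → (toℕ h * u + toℕ h * v) % m ≡ 0) (sym x≡2i+1) (sym y≡2j+1)
                         (half*[odd+odd]%m≡0 (toℕ h) 2h≡m i j))

  consecutive-singleton : ∀ {x : Fin m} → HasConsecutiveWZS m (x ∷ []) → WeightedZeroSum m (x ∷ [])
  consecutive-singleton ([] , _ ∷ [] , [] , refl , wzs) = wzs
  consecutive-singleton ([] , [] , _ , _ , (T≢[] , _)) = ⊥-elim (T≢[] refl)
  consecutive-singleton (_ ∷ [] , [] , _ , _ , (T≢[] , _)) = ⊥-elim (T≢[] refl)
  consecutive-singleton ([] , _ ∷ [] , _ ∷ _ , () , _)
  consecutive-singleton ([] , _ ∷ _ ∷ _ , _ , () , _)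
  consecutive-singleton (_ ∷ [] , _ ∷ _ , _ , () , _)
  consecutive-singleton (_ ∷ _ ∷ _ , _ , _ , () , _)

  ¬wzs-one : ∀ {x : Fin m} → toℕ x ≡ 1 → ¬ WeightedZeroSum m (x ∷ [])
  ¬wzs-one {x} x≡1 (_ , a ∷ [] , _ , (a≢0 , _) ∷ [] , ax≡0) = a≢0 (begin
    toℕ a                   ≡⟨ sym (m<n⇒m%n≡m (toℕ<n a)) ⟩
    toℕ a % m               ≡⟨ cong (_% m) (sym a*x+0≡a) ⟩
    (toℕ a * toℕ x + 0) % m ≡⟨ ax≡0 ⟩
    0                       ∎)
    where
    open ≡-Reasoning
    a*x+0≡a : toℕ a * toℕ x + 0 ≡ toℕ a
    a*x+0≡a = trans (+-identityʳ _) (trans (cong (toℕ a *_) x≡1) (*-identityʳ (toℕ a)))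

  ¬prop-1 : 1 < m → ¬ Prop-k m 1
  ¬prop-1 1<m P = ¬wzs-one (toℕ-fromℕ< 1<m) (consecutive-singleton (P (fromℕ< 1<m ∷ []) refl))

  isC-Sstar-2 : Prop-k m 2 → ¬ Prop-k m 1 → IsC-Sstar m 2
  isC-Sstar-2 P₂ ¬P₁ = s≤s z≤n , P₂ , λ { (suc zero) _ _ → ¬P₁ ; (suc (suc _)) _ (s≤s (s≤s ())) }

module OddPowerOfTwo (q : ℕ) where

  m : ℕ
  m = 2 ^ suc (2 * q)

  instance
    m≢0 : NonZero m
    m≢0 = m^n≢0 2 (suc (2 * q))

  h : ℕ
  h = 2 ^ (2 * q)

  0<h : 0 < h
  0<h = m^n>0 2 (2 * q)

  h<m : h < m
  h<m = subst (h <_) (cong (h +_) (sym (+-identityʳ h))) (m<m+n h 0<h)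

  √h<m : 2 ^ q < m
  √h<m = ≤-<-trans (^-monoʳ-≤ 2 (m≤m+n q (q + 0))) h<m

  half : Fin m
  half = fromℕ< h<m

  half-square : InSstar m half
  half-square = h≢0 , fromℕ< √h<m , (begin
      (toℕ (fromℕ< √h<m) * toℕ (fromℕ< √h<m)) % m ≡⟨ cong (λ z → (z * z) % m) (toℕ-fromℕ< √h<m) ⟩
      (2 ^ q * 2 ^ q) % m                         ≡⟨ cong (_% m) (sym (^-distribˡ-+-* 2 q q)) ⟩
      (2 ^ (q + q)) % m                           ≡⟨ cong (λ z → (2 ^ (q + z)) % m) (sym (+-identityʳ q)) ⟩
      h % m                                       ≡⟨ m<n⇒m%n≡m h<m ⟩
      h                                           ≡⟨ sym (toℕ-fromℕ< h<m) ⟩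
      toℕ half ∎)
    where
    open ≡-Reasoning
    h≢0 : toℕ half ≢ 0
    h≢0 rewrite toℕ-fromℕ< h<m = ≢-sym (<⇒≢ 0<h)

  2*half≡m : 2 * toℕ half ≡ m
  2*half≡m = cong (2 *_) (toℕ-fromℕ< h<m)

  1<m : 1 < m
  1<m = ≤-trans (s≤s 0<h) h<m

theorem2 : (r : ℕ) → Odd r →
    ∃[ c ] (IsC-Sstar (2 ^ r) {{m^n≢0 2 r}} c × c ≤ 2)
theorem2 .(suc (2 * q)) (q , refl) =
  2 , isC-Sstar-2 (prop-2-of-half half half-square 2*half≡m) (¬prop-1 1<m) , ≤-refl
  where open OddPowerOfTwo q
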